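{- Let $G=(V,E)$ be a graph in which every vertex has degree at least three, in which no cycle consists only of degree-three vertices, and in which no connected subgraph consists of nine or more degree-three vertices. Let $F$ be a maximal low-magnitude bushy forest in $G$. Then one can find a maximal high-magnitude chromatic forest in $G[V\setminus V(F)]$.
   Context: A bushy forest in $G$ is a forest $F$ (a subgraph of $G$) in which every tree has at least one internal vertex and every internal vertex is adjacent (in the tree) to at least four other vertices of its tree. $F$ is maximal if no vertex outside $F$ has four neighbors outside $F$, no leaf of $F$ has three neighbors outside $F$, and no vertex outside $F$ is adjacent to an internal vertex of $F$. A high-magnitude vertex is a vertex not in $F$ adjacent to some vertex of $F$ and having three neighbors outside $F$; $N_3$ denotes the set of high-magnitude vertices. $F$ is a maximal low-magnitude bushy forest if it is maximal, every tree of $F$ adjacent to a high-magnitude vertex has exactly one internal vertex and exactly four leaves, and any two high-magnitude vertices adjacent to the same tree have a common neighbor that is either a leaf of that tree or a vertex outside $F$. $U$ denotes the set of vertices outside $F$ not adjacent to any vertex of $F$, and $U'$ the set of vertices of $U$ all three of whose neighbors lie in $N_3$. A chromatic forest (in $G[V\setminus V(F)]$) is a forest of rooted trees in which the root of each tree has exactly three children and at most five grandchildren, and each child of the root has at most two children. A maximal chromatic forest is a chromatic forest covering all vertices of $U$. A maximal high-magnitude chromatic forest is a maximal chromatic forest that additionally covers every vertex of $N_3$ adjacent to a vertex of $U'$. -}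

module Defs where

open import Data.Nat using (ℕ; zero; suc; _+_; _≤_; _≥_)
open import Data.Fin using (Fin; zero; suc; _≟_)
open import Relation.Nullary.Decidable using (does)
open import Data.Bool using (Bool; true; false; if_then_else_; _∧_; _∨_; not)
open import Data.List using (List; []; _∷_; _++_; [_]; length)
open import Data.List.Relation.Unary.All using (All)
open import Data.List.Relation.Unary.Unique.Propositional using (Unique)
open import Data.List.Membership.Propositional using (_∈_)
open import Data.Product using (Σ; ∃; _×_; _,_)
open import Data.Sum using (_⊎_)
open import Data.Unit using (⊤)
open import Data.Empty using (⊥)
open import Relation.Nullary using (¬_)
open import Relation.Binary.PropositionalEquality using (_≡_; _≢_)
open import Function using (_∘_; _⇔_)

count : ∀ {n} → (Fin n → Bool) → ℕ
count {zero}  p = 0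
count {suc n} p = (if p zero then 1 else 0) + count (p ∘ suc)

anyFin : ∀ {n} → (Fin n → Bool) → Bool
anyFin {zero}  p = false
anyFin {suc n} p = p zero ∨ anyFin (p ∘ suc)

_≠ᵇ_ : ∀ {n} → Fin n → Fin n → Bool
u ≠ᵇ v = not (does (u ≟ v))

record Graph (n : ℕ) : Set where
  field
    adj    : Fin n → Fin n → Bool
    sym    : ∀ u v → adj u v ≡ adj v u
    irrefl : ∀ v → adj v v ≡ false

open Graph public

Adj : ∀ {n} → Graph n → Fin n → Fin n → Set
Adj G u v = adj G u v ≡ true

degree : ∀ {n} → Graph n → Fin n → ℕ
degree G v = count (adj G v)

data Reach {n : ℕ} (E : Fin n → Fin n → Set) : Fin n → Fin n → Set where
  here : ∀ {u} → Reach E u u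
  step : ∀ {u v w} → E u v → Reach E v w → Reach E u w

Chain : ∀ {n} → (Fin n → Fin n → Set) → List (Fin n) → Set
Chain E []            = ⊤
Chain E (x ∷ [])      = ⊤
Chain E (x ∷ y ∷ zs)  = E x y × Chain E (y ∷ zs)

IsCycle : ∀ {n} → (Fin n → Fin n → Set) → List (Fin n) → Set
IsCycle E []       = ⊥
IsCycle E (v ∷ vs) = (2 ≤ length vs) × Unique (v ∷ vs) × Chain E ((v ∷ vs) ++ [ v ])

record SubForest {n : ℕ} (G : Graph n) : Set where
  field
    vert     : Fin n → Bool
    edge     : Fin n → Fin n → Bool
    edge-sym : ∀ u v → edge u v ≡ edge v u
    edge-adj : ∀ u v → edge u v ≡ true → Adj G u v
    edge-vert : ∀ u v → edge u v ≡ true → vert u ≡ true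
    acyclic  : ∀ vs → ¬ IsCycle (λ u v → edge u v ≡ true) vs

open SubForest public

module _ {n : ℕ} {G : Graph n} (F : SubForest G) where

  InF : Fin n → Set
  InF v = vert F v ≡ true

  OutF : Fin n → Set
  OutF v = vert F v ≡ false

  EdgeF : Fin n → Fin n → Set
  EdgeF u v = edge F u v ≡ true

  degF : Fin n → ℕ
  degF v = count (edge F v)

  SameTree : Fin n → Fin n → Set
  SameTree = Reach EdgeF

  Internal : Fin n → Set
  Internal v = InF v × 2 ≤ degF v

  Leaf : Fin n → Set
  Leaf v = InF v × ¬ (2 ≤ degF v)

  outDeg : Fin n → ℕ
  outDeg v = count (λ w → adj G v w ∧ not (vert F w))

  TreeAdj : Fin n → Fin n → Set
  TreeAdj r x = ∃ λ u → SameTree r u × Adj G x u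

  Bushy : Set
  Bushy = (∀ v → InF v → ∃ λ c → Internal c × SameTree v c)
        × (∀ c → Internal c → 4 ≤ degF c)

  Maximal : Set
  Maximal = (∀ v → OutF v → ¬ (4 ≤ outDeg v))
          × (∀ v → Leaf v → ¬ (3 ≤ outDeg v))
          × (∀ v c → OutF v → Internal c → ¬ Adj G v c)

  HighMag : Fin n → Set
  HighMag v = OutF v × (∃ λ u → InF u × Adj G v u) × 3 ≤ outDeg v

  OneInternalFourLeaves : Fin n → Set
  OneInternalFourLeaves r =
      (∃ λ c → Internal c × SameTree r c × (∀ c' → Internal c' → SameTree r c' → c' ≡ c))
    × (∃ λ (ls : List (Fin n)) → length ls ≡ 4 × Unique ls
         × (∀ l → (Leaf l × SameTree r l) ⇔ (l ∈ ls)))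

  LowMagnitude : Set
  LowMagnitude =
      (∀ r x → InF r → HighMag x → TreeAdj r x → OneInternalFourLeaves r)
    × (∀ r x y → InF r → HighMag x → HighMag y → x ≢ y → TreeAdj r x → TreeAdj r y →
         ∃ λ z → Adj G x z × Adj G y z × ((Leaf z × SameTree r z) ⊎ OutF z))

  MaximalLowMagBushy : Set
  MaximalLowMagBushy = Bushy × Maximal × LowMagnitude

  InU : Fin n → Set
  InU v = OutF v × (∀ u → Adj G v u → OutF u)

  InU' : Fin n → Set
  InU' v = InU v × (∀ u → Adj G v u → HighMag u)

  record ChromaticForest : Set where
    field
      forest  : SubForest G
      avoidF  : ∀ v → vert forest v ≡ true → OutF v
      isRoot  : Fin n → Bool
      root-in : ∀ v → isRoot v ≡ true → vert forest v ≡ true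
      rooted  : ∀ v → vert forest v ≡ true →
                  ∃ λ r → isRoot r ≡ true × Reach (λ a b → edge forest a b ≡ true) v r
      root-unique : ∀ r r' → isRoot r ≡ true → isRoot r' ≡ true →
                  Reach (λ a b → edge forest a b ≡ true) r r' → r ≡ r'
      three-children : ∀ r → isRoot r ≡ true → count (edge forest r) ≡ 3
      -- children of a child c of r: forest-neighbours of c other than r
      child-children : ∀ r c → isRoot r ≡ true → edge forest r c ≡ true →
                  count (λ w → edge forest c w ∧ (w ≠ᵇ r)) ≤ 2
      -- grandchildren of r: vertices ≠ r forest-adjacent to some child of r
      five-grandchildren : ∀ r → isRoot r ≡ true →
                  count (λ w → (w ≠ᵇ r) ∧
                     anyFin (λ c → edge forest r c ∧ edge forest c w)) ≤ 5

  open ChromaticForest public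

  Covers : ChromaticForest → (Fin n → Set) → Set
  Covers C P = ∀ v → P v → vert (forest C) v ≡ true

  MaximalHighMagChromatic : ChromaticForest → Set
  MaximalHighMagChromatic C =
      Covers C InU
    × Covers C (λ x → HighMag x × ∃ λ u → InU' u × Adj G x u)

MinDegree3 : ∀ {n} → Graph n → Set
MinDegree3 G = ∀ v → 3 ≤ degree G v

NoDeg3Cycle : ∀ {n} → Graph n → Set
NoDeg3Cycle G = ∀ vs → IsCycle (Adj G) vs → ¬ All (λ v → degree G v ≡ 3) vs

NoLargeDeg3Component : ∀ {n} → Graph n → Set
NoLargeDeg3Component {n} G = ∀ (S : Fin n → Bool) →
    9 ≤ count S →
    (∀ v → S v ≡ true → degree G v ≡ 3) →
    ¬ (∀ u v → S u ≡ true → S v ≡ true →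
         Reach (λ a b → Adj G a b × S a ≡ true × S b ≡ true) u v)

module Submission where

-- Every vertex
-- outside F has at most three neighbours outside F, and a vertex of U has exactly three, all
-- outside F.  Pick greedily a maximal set of centres in U, pairwise at distance at least three
-- in G[V ∖ V(F)]: every vertex of U is within distance two of a centre, so every vertex outside F
-- adjacent to U is within distance three.  Grow breadth-first trees of depth three from the
-- centres; by the separation, each centre keeps all three of its neighbours as children.  In each
-- tree take as root a vertex of tree-degree three of largest depth: its children other than its
-- parent are deeper and so have tree-degree at most two, which leaves at most 2 + 1 + 1
-- grandchildren.

open import Defs
open import Data.Nat using (ℕ; zero; suc; pred; _+_; _≤_; _<_; z≤n; s≤s; ≢-nonZero)
import Data.Nat.Properties as ℕ
open import Data.Fin using (Fin; zero; suc; toℕ; _≟_)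
open import Data.Fin.Properties using (suc-injective; toℕ-injective; toℕ<n; 0≢1+n; any?; all?)
open import Data.Bool using (Bool; true; false; _∧_; _∨_; not; if_then_else_)
import Data.Bool.Properties as Bool
open import Data.List using (List; []; _∷_; _++_; [_]; filter; allFin)
open import Data.List.Relation.Unary.All as All using (All; _∷_)
open import Data.List.Relation.Unary.All.Properties using (all-filter)
open import Data.List.Relation.Unary.AllPairs using (_∷_)
open import Data.List.Relation.Unary.Unique.Propositional using (Unique)
open import Data.List.Membership.Propositional.Properties using (∈-filter⁺; ∈-allFin)
open import Data.List.Extrema.Nat using (argmax; argmax-all; f[xs]≤f[argmax])
open import Algebra.Properties.CommutativeMonoid.Sum ℕ.+-0-commutativeMonoid using (sum; ∑-distrib-+)
open import Data.Product as Product using (∃; _×_; _,_; proj₁; proj₂)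
open import Data.Sum as Sum using (_⊎_; inj₁; inj₂)
open import Data.Empty using (⊥; ⊥-elim)
open import Data.Unit using (⊤)
open import Function using (_∘_; mk⇔)
open import Relation.Nullary using (¬_; Dec; yes; no; does)
open import Relation.Nullary.Decidable using (dec-true; dec-false; decidable-stable; does-⇔; _⊎-dec_; _×-dec_; _→-dec_; ¬?)
open import Relation.Binary.PropositionalEquality as ≡ using (_≡_; _≢_; refl; trans; cong; cong₂; subst)

does-true⁻ : ∀ {P : Set} (P? : Dec P) → does P? ≡ true → P
does-true⁻ (yes p) _ = p

true⇒≢false : ∀ {x} → x ≡ true → ¬ x ≡ false
true⇒≢false refl ()

∧-intro : ∀ {x y} → x ≡ true → y ≡ true → x ∧ y ≡ true
∧-intro refl refl = refl

∨-elim : ∀ x {y} → x ∨ y ≡ true → x ≡ true ⊎ y ≡ true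
∨-elim true  _ = inj₁ refl
∨-elim false e = inj₂ e

≠ᵇ-irrefl : ∀ {n} (x : Fin n) → (x ≠ᵇ x) ≡ false
≠ᵇ-irrefl x = cong not (dec-true (x ≟ x) refl)

anyFin-intro : ∀ {n} (p : Fin n → Bool) i → p i ≡ true → anyFin p ≡ true
anyFin-intro p zero    e rewrite e = refl
anyFin-intro p (suc i) e with p zero
... | true  = refl
... | false = anyFin-intro (p ∘ suc) i e

anyFin-elim : ∀ {n} (p : Fin n → Bool) → anyFin p ≡ true → ∃ λ i → p i ≡ true
anyFin-elim {suc n} p e with ∨-elim (p zero) e
... | inj₁ e₀ = zero , e₀
... | inj₂ e₁ with anyFin-elim (p ∘ suc) e₁
...   | i , eᵢ = suc i , eᵢ

_⊆ᵇ_ : ∀ {n} → (Fin n → Bool) → (Fin n → Bool) → Set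
p ⊆ᵇ q = ∀ i → p i ≡ true → q i ≡ true

count-mono : ∀ {n} {p q : Fin n → Bool} → p ⊆ᵇ q → count p ≤ count q
count-mono {zero}          p⊆q = z≤n
count-mono {suc n} {p} {q} p⊆q with p zero in e₀ | q zero in e₁
... | true  | true  = s≤s (count-mono (p⊆q ∘ suc))
... | true  | false = ⊥-elim (true⇒≢false (p⊆q zero e₀) e₁)
... | false | true  = ℕ.m≤n⇒m≤1+n (count-mono (p⊆q ∘ suc))
... | false | false = count-mono (p⊆q ∘ suc)

count-< : ∀ {n} {p q : Fin n → Bool} x → p x ≡ false → q x ≡ true → p ⊆ᵇ q → count p < count q
count-< {suc n} {p} {q} zero px qx p⊆q rewrite px | qx = s≤s (count-mono (p⊆q ∘ suc))
count-< {suc n} {p} {q} (suc x) px qx p⊆q with p zero in e₀ | q zero in e₁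
... | true  | true  = s≤s (count-< x px qx (p⊆q ∘ suc))
... | true  | false = ⊥-elim (true⇒≢false (p⊆q zero e₀) e₁)
... | false | true  = ℕ.m≤n⇒m≤1+n (count-< x px qx (p⊆q ∘ suc))
... | false | false = count-< x px qx (p⊆q ∘ suc)

count-none : ∀ {n} (p : Fin n → Bool) → (∀ i → p i ≢ true) → count p ≡ 0
count-none {zero}  p none = refl
count-none {suc n} p none with p zero in e₀
... | true  = ⊥-elim (none zero e₀)
... | false = count-none (p ∘ suc) (none ∘ suc)

count-≤1 : ∀ {n} (p : Fin n → Bool) → (∀ i j → p i ≡ true → p j ≡ true → i ≡ j) → count p ≤ 1
count-≤1 {zero}  p unique = z≤n
count-≤1 {suc n} p unique with p zero in e₀
... | true  = s≤s (ℕ.≤-reflexive (count-none (p ∘ suc) λ i eᵢ → 0≢1+n (unique zero (suc i) e₀ eᵢ)))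
... | false = count-≤1 (p ∘ suc) λ i j eᵢ eⱼ → suc-injective (unique (suc i) (suc j) eᵢ eⱼ)

count-∨ : ∀ {n} (p q : Fin n → Bool) → count (λ i → p i ∨ q i) ≤ count p + count q
count-∨ {zero}  p q = z≤n
count-∨ {suc n} p q with p zero | q zero
... | true  | true  =
  s≤s (ℕ.≤-trans (count-∨ (p ∘ suc) (q ∘ suc)) (ℕ.+-monoʳ-≤ (count (p ∘ suc)) (ℕ.n≤1+n _)))
... | true  | false = s≤s (count-∨ (p ∘ suc) (q ∘ suc))
... | false | true  = ℕ.≤-trans (s≤s (count-∨ (p ∘ suc) (q ∘ suc))) (ℕ.≤-reflexive (≡.sym (ℕ.+-suc _ _)))
... | false | false = count-∨ (p ∘ suc) (q ∘ suc)

count-anyFin≤sum : ∀ {m n} (q : Fin m → Fin n → Bool) →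
                   count (λ w → anyFin (λ c → q c w)) ≤ sum (λ c → count (q c))
count-anyFin≤sum {zero} {n} q = ℕ.≤-reflexive (count-none {n} (λ _ → false) λ _ ())
count-anyFin≤sum {suc m} q =
  ℕ.≤-trans (count-∨ (q zero) _) (ℕ.+-monoʳ-≤ (count (q zero)) (count-anyFin≤sum (q ∘ suc)))

indicator : Bool → ℕ
indicator b = if b then 1 else 0

count≡sum : ∀ {n} (p : Fin n → Bool) → count p ≡ sum (indicator ∘ p)
count≡sum {zero}  p = refl
count≡sum {suc n} p = cong (indicator (p zero) +_) (count≡sum (p ∘ suc))

sum-mono-≤ : ∀ {n} {f g : Fin n → ℕ} → (∀ i → f i ≤ g i) → sum f ≤ sum g
sum-mono-≤ {zero}  f≤g = z≤n
sum-mono-≤ {suc n} f≤g = ℕ.+-mono-≤ (f≤g zero) (sum-mono-≤ (f≤g ∘ suc))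

module _ {n : ℕ} {E : Fin n → Fin n → Set} where

  Reach-trans : ∀ {u v w} → Reach E u v → Reach E v w → Reach E u w
  Reach-trans here       q = q
  Reach-trans (step e p) q = step e (Reach-trans p q)

  Reach-sym : (∀ {u v} → E u v → E v u) → ∀ {u v} → Reach E u v → Reach E v u
  Reach-sym E-sym here       = here
  Reach-sym E-sym (step e p) = Reach-trans (Reach-sym E-sym p) (step (E-sym e) here)

  Reach-invariant : ∀ {A : Set} (f : Fin n → A) → (∀ {u v} → E u v → f u ≡ f v) →
                    ∀ {u v} → Reach E u v → f u ≡ f v
  Reach-invariant f f-inv here       = refl
  Reach-invariant f f-inv (step e p) = trans (f-inv e) (Reach-invariant f f-inv p)

-- Defaults to b when no k ≤ b satisfies P.
least : ∀ {P : ℕ → Set} → (∀ k → Dec (P k)) → ℕ → ℕ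
least P? zero    = zero
least P? (suc b) = if does (P? 0) then 0 else suc (least (P? ∘ suc) b)

least-≤-bound : ∀ {P : ℕ → Set} (P? : ∀ k → Dec (P k)) b → least P? b ≤ b
least-≤-bound P? zero    = z≤n
least-≤-bound P? (suc b) with P? 0
... | yes _ = z≤n
... | no  _ = s≤s (least-≤-bound (P? ∘ suc) b)

least-minimal : ∀ {P : ℕ → Set} (P? : ∀ k → Dec (P k)) b {k} → P k → least P? b ≤ k
least-minimal P? zero    p = z≤n
least-minimal P? (suc b) p with P? 0
least-minimal P? (suc b) p       | yes _  = z≤n
least-minimal P? (suc b) {zero}  p | no ¬p₀ = ⊥-elim (¬p₀ p)
least-minimal P? (suc b) {suc k} p | no _   = s≤s (least-minimal (P? ∘ suc) b p)

least-holds : ∀ {P : ℕ → Set} (P? : ∀ k → Dec (P k)) b {k} → k ≤ b → P k → P (least P? b)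
least-holds P? zero    z≤n p = p
least-holds P? (suc b) k≤b p with P? 0
least-holds P? (suc b) k≤b       p | yes p₀ = p₀
least-holds P? (suc b) {zero} k≤b  p | no ¬p₀ = ⊥-elim (¬p₀ p)
least-holds P? (suc b) {suc k} (s≤s k≤b) p | no _ = least-holds (P? ∘ suc) b k≤b p

choose : ∀ {n} {P : Fin n → Set} → (∀ i → Dec (P i)) → Fin n → Fin n
choose P? default with any? P?
... | yes (i , _) = i
... | no  _       = default

choose-holds : ∀ {n} {P : Fin n → Set} (P? : ∀ i → Dec (P i)) default {i} → P i → P (choose P? default)
choose-holds P? default p with any? P?
... | yes (_ , pᵢ) = pᵢ
... | no  none     = ⊥-elim (none (_ , p))

module GreedySeparated {n : ℕ} {P : Fin n → Set} (P? : ∀ a → Dec (P a))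
  {Close : Fin n → Fin n → Set} (Close? : ∀ a b → Dec (Close a b))
  (Close-sym : ∀ {a b} → Close a b → Close b a) where

  Picked : ℕ → Fin n → Set
  Picked zero    a = ⊥
  Picked (suc m) a = Picked m a ⊎ (toℕ a ≡ m × P a × ¬ ∃ λ b → Picked m b × Close a b)

  Picked? : ∀ m a → Dec (Picked m a)
  Picked? zero    a = no λ ()
  Picked? (suc m) a =
    Picked? m a ⊎-dec (toℕ a ℕ.≟ m ×-dec P? a ×-dec ¬? (any? λ b → Picked? m b ×-dec Close? a b))

  Picked⇒P : ∀ m {a} → Picked m a → P a
  Picked⇒P (suc m) (inj₁ old)          = Picked⇒P m old
  Picked⇒P (suc m) (inj₂ (_ , pa , _)) = pa

  Picked-separated : ∀ m {a b} → Picked m a → Picked m b → a ≢ b → ¬ Close a b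
  Picked-separated (suc m) (inj₁ a-old) (inj₁ b-old) a≢b = Picked-separated m a-old b-old a≢b
  Picked-separated (suc m) (inj₁ a-old) (inj₂ (_ , _ , far)) _ close = far (_ , a-old , Close-sym close)
  Picked-separated (suc m) (inj₂ (_ , _ , far)) (inj₁ b-old) _ close = far (_ , b-old , close)
  Picked-separated (suc m) (inj₂ (a≡m , _)) (inj₂ (b≡m , _)) a≢b _ = a≢b (toℕ-injective (trans a≡m (≡.sym b≡m)))

  Picked-dominating : ∀ m {a} → P a → toℕ a < m → Picked m a ⊎ ∃ λ b → Picked m b × Close a b
  Picked-dominating (suc m) {a} pa a<1+m with ℕ.m≤n⇒m<n∨m≡n (ℕ.≤-pred a<1+m)
  ... | inj₁ a<m = Sum.map inj₁ (Product.map₂ (Product.map₁ inj₁)) (Picked-dominating m pa a<m)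
  ... | inj₂ a≡m with any? (λ b → Picked? m b ×-dec Close? a b)
  ...   | yes (b , picked , close) = inj₂ (b , inj₁ picked , close)
  ...   | no far                   = inj₁ (inj₂ (a≡m , pa , far))

module ParentForest {n : ℕ} (E Parent : Fin n → Fin n → Set) (ρ : Fin n → ℕ)
  (E⇒Parent : ∀ {x y} → E x y → Parent x y ⊎ Parent y x)
  (Parent-functional : ∀ {x y z} → Parent x y → Parent x z → y ≡ z)
  (Parent-decreasing : ∀ {x y} → Parent x y → ρ y < ρ x) where

  NonBacktracking : List (Fin n) → Set
  NonBacktracking (x ∷ y ∷ z ∷ zs) = x ≢ z × NonBacktracking (y ∷ z ∷ zs)
  NonBacktracking _                = ⊤

  lastOf : Fin n → List (Fin n) → Fin n
  lastOf x []       = x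
  lastOf x (y ∷ ys) = lastOf y ys

  EndsDownward : Fin n → List (Fin n) → Set
  EndsDownward x []           = ⊥
  EndsDownward x (y ∷ [])     = Parent y x
  EndsDownward x (y ∷ z ∷ zs) = EndsDownward y (z ∷ zs)

  -- A vertex has only one parent, so once a non-backtracking walk moves from a parent
  -- to a child it can never move back up.
  downward-persists : ∀ x y zs → Chain E (x ∷ y ∷ zs) → NonBacktracking (x ∷ y ∷ zs) → Parent y x →
                      EndsDownward x (y ∷ zs) × ρ x < ρ (lastOf y zs)
  downward-persists x y []       _              _            y↑x = y↑x , Parent-decreasing y↑x
  downward-persists x y (z ∷ zs) (_ , e , walk) (x≢z , nb) y↑x with E⇒Parent e
  ... | inj₁ z-parent = ⊥-elim (x≢z (Parent-functional y↑x z-parent))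
  ... | inj₂ z↑y      = Product.map₂ (ℕ.<-trans (Parent-decreasing y↑x))
                                     (downward-persists y z zs (e , walk) nb z↑y)

  upward-then-downward : ∀ x y zs → Chain E (x ∷ y ∷ zs) → NonBacktracking (x ∷ y ∷ zs) →
                         ρ (lastOf y zs) < ρ x ⊎ EndsDownward x (y ∷ zs)
  upward-then-downward x y zs walk nb with E⇒Parent (proj₁ walk)
  ... | inj₂ y↑x = inj₂ (proj₁ (downward-persists x y zs walk nb y↑x))
  upward-then-downward x y []       walk nb | inj₁ x↑y = inj₁ (Parent-decreasing x↑y)
  upward-then-downward x y (z ∷ zs) (_ , walk) (_ , nb) | inj₁ x↑y =
    Sum.map₁ (λ lt → ℕ.<-trans lt (Parent-decreasing x↑y)) (upward-then-downward y z zs walk nb)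

  lastOf-snoc : ∀ y zs w → lastOf y (zs ++ [ w ]) ≡ w
  lastOf-snoc y []       w = refl
  lastOf-snoc y (z ∷ zs) w = lastOf-snoc z zs w

  EndsDownward-snoc : ∀ x y zs w → EndsDownward x (y ∷ zs ++ [ w ]) → Parent w (lastOf y zs)
  EndsDownward-snoc x y []       w d = d
  EndsDownward-snoc x y (z ∷ zs) w d = EndsDownward-snoc y z zs w d

  All-lastOf : ∀ {Q : Fin n → Set} y zs → All Q (y ∷ zs) → Q (lastOf y zs)
  All-lastOf y []       (q ∷ _)  = q
  All-lastOf y (z ∷ zs) (_ ∷ qs) = All-lastOf z zs qs

  NonBacktracking-snoc : ∀ ys w → Unique ys → All (w ≢_) ys → NonBacktracking (ys ++ [ w ])
  NonBacktracking-snoc []                w _                     _              = _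
  NonBacktracking-snoc (x ∷ [])          w _                     _              = _
  NonBacktracking-snoc (x ∷ y ∷ [])      w _                     (w≢x ∷ _)      = w≢x ∘ ≡.sym , _
  NonBacktracking-snoc (x ∷ y ∷ z ∷ ys) w ((_ ∷ x≢z ∷ _) ∷ u) (_ ∷ w≢ys)    =
    x≢z , NonBacktracking-snoc (y ∷ z ∷ ys) w u w≢ys

  closed-walk-returns-backwards : ∀ v a b rest →
    Chain E (v ∷ a ∷ b ∷ rest ++ [ v ]) → NonBacktracking (v ∷ a ∷ b ∷ rest ++ [ v ]) → a ≡ lastOf b rest
  closed-walk-returns-backwards v a b rest walk nb with upward-then-downward v a (b ∷ rest ++ [ v ]) walk nb
  ... | inj₁ lt = ⊥-elim (ℕ.<-irrefl (cong ρ (lastOf-snoc a (b ∷ rest) v)) lt)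
  ... | inj₂ ends with E⇒Parent (proj₁ walk)
  ...   | inj₁ v↑a = Parent-functional v↑a (EndsDownward-snoc v a (b ∷ rest) v ends)
  ...   | inj₂ a↑v = ⊥-elim (ℕ.<-irrefl (cong ρ (≡.sym (lastOf-snoc a (b ∷ rest) v)))
                                       (proj₂ (downward-persists v a (b ∷ rest ++ [ v ]) walk nb a↑v)))

  ¬IsCycle : ∀ vs → ¬ IsCycle E vs
  ¬IsCycle (v ∷ [])     (() , _)
  ¬IsCycle (v ∷ a ∷ []) (s≤s () , _)
  ¬IsCycle (v ∷ a ∷ b ∷ rest) (_ , (v≢abr@(_ ∷ v≢b ∷ _) ∷ a≢br ∷ u) , walk) =
    All-lastOf b rest a≢br (closed-walk-returns-backwards v a b rest walk
                              (v≢b , NonBacktracking-snoc (a ∷ b ∷ rest) v (a≢br ∷ u) v≢abr))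

module Construction {n : ℕ} (G : Graph n) (F : SubForest G) (min-degree : MinDegree3 G)
  (outDeg≤3 : ∀ v → OutF F v → ¬ 4 ≤ outDeg F v) where

  Adj? : ∀ u v → Dec (Adj G u v)
  Adj? u v = adj G u v Bool.≟ true

  OutF? : ∀ v → Dec (OutF F v)
  OutF? v = vert F v Bool.≟ false

  Adj∖F : Fin n → Fin n → Set
  Adj∖F u v = Adj G u v × OutF F u × OutF F v

  Adj∖F? : ∀ u v → Dec (Adj∖F u v)
  Adj∖F? u v = Adj? u v ×-dec OutF? u ×-dec OutF? v

  Adj∖F-sym : ∀ {u v} → Adj∖F u v → Adj∖F v u
  Adj∖F-sym {u} {v} (uv , ou , ov) = trans (Graph.sym G v u) uv , ov , ou

  Adj∖F-irrefl : ∀ {u v} → Adj∖F u v → u ≢ v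
  Adj∖F-irrefl {u} (uu , _) refl = true⇒≢false uu (irrefl G u)

  InU? : ∀ v → Dec (InU F v)
  InU? v = OutF? v ×-dec all? (λ u → Adj? v u →-dec OutF? u)

  InU-Adj∖F : ∀ {a w} → InU F a → Adj G a w → Adj∖F a w
  InU-Adj∖F (oa , nbrs-out) aw = aw , oa , nbrs-out _ aw

  Near : Fin n → Fin n → Set
  Near a b = a ≡ b ⊎ Adj∖F a b ⊎ ∃ λ x → Adj∖F a x × Adj∖F x b

  Near? : ∀ a b → Dec (Near a b)
  Near? a b = a ≟ b ⊎-dec Adj∖F? a b ⊎-dec any? (λ x → Adj∖F? a x ×-dec Adj∖F? x b)

  Near-sym : ∀ {a b} → Near a b → Near b a
  Near-sym (inj₁ refl)                  = inj₁ refl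
  Near-sym (inj₂ (inj₁ ab))             = inj₂ (inj₁ (Adj∖F-sym ab))
  Near-sym (inj₂ (inj₂ (x , ax , xb))) = inj₂ (inj₂ (x , Adj∖F-sym xb , Adj∖F-sym ax))

  open GreedySeparated InU? Near? Near-sym

  opaque
    Centre : Fin n → Set
    Centre = Picked n

    Centre? : ∀ a → Dec (Centre a)
    Centre? = Picked? n

    Centre⇒InU : ∀ {a} → Centre a → InU F a
    Centre⇒InU = Picked⇒P n

    Centre-separated : ∀ {a b} → Centre a → Centre b → a ≢ b → ¬ Near a b
    Centre-separated = Picked-separated n

    InU-near-Centre : ∀ {v} → InU F v → ∃ λ a → Centre a × Near v a
    InU-near-Centre {v} u with Picked-dominating n u (toℕ<n v)
    ... | inj₁ centre = v , centre , inj₁ refl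
    ... | inj₂ near   = near

  Ball : ℕ → Fin n → Set
  Ball zero    v = Centre v
  Ball (suc k) v = Ball k v ⊎ ∃ λ w → Adj∖F v w × Ball k w

  Ball? : ∀ k v → Dec (Ball k v)
  Ball? zero    v = Centre? v
  Ball? (suc k) v = Ball? k v ⊎-dec any? (λ w → Adj∖F? v w ×-dec Ball? k w)

  Ball-mono : ∀ {k j v} → k ≤ j → Ball k v → Ball j v
  Ball-mono {j = zero}  z≤n b = b
  Ball-mono {j = suc j} k≤1+j b with ℕ.m≤n⇒m<n∨m≡n k≤1+j
  ... | inj₁ k<1+j = inj₁ (Ball-mono (ℕ.≤-pred k<1+j) b)
  ... | inj₂ refl  = b

  Ball-step : ∀ {k v w} → Adj∖F v w → Ball k w → Ball (suc k) v
  Ball-step e b = inj₂ (_ , e , b)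

  Ball⇒OutF : ∀ k {v} → Ball k v → OutF F v
  Ball⇒OutF zero    c                 = proj₁ (Centre⇒InU c)
  Ball⇒OutF (suc k) (inj₁ b)          = Ball⇒OutF k b
  Ball⇒OutF (suc k) (inj₂ (_ , e , _)) = proj₁ (proj₂ e)

  InU⇒Ball₂ : ∀ {v} → InU F v → Ball 2 v
  InU⇒Ball₂ u with InU-near-Centre u
  ... | a , c , inj₁ refl                = Ball-mono {0} {2} z≤n c
  ... | a , c , inj₂ (inj₁ va)           = inj₁ (Ball-step {0} va c)
  ... | a , c , inj₂ (inj₂ (x , vx , xa)) = Ball-step {1} vx (Ball-step {0} xa c)

  Covered : Fin n → Set
  Covered = Ball 3

  Covered? : ∀ v → Dec (Covered v)
  Covered? = Ball? 3

  opaque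
    level : Fin n → ℕ
    level v = least (λ k → Ball? k v) 3

    level≤3 : ∀ v → level v ≤ 3
    level≤3 v = least-≤-bound (λ k → Ball? k v) 3

    level-minimal : ∀ {k v} → Ball k v → level v ≤ k
    level-minimal {v = v} = least-minimal (λ k → Ball? k v) 3

    Ball-level : ∀ {v} → Covered v → Ball (level v) v
    Ball-level {v} = least-holds (λ k → Ball? k v) 3 ℕ.≤-refl

  Ball⇒Covered : ∀ {k v} → k ≤ 3 → Ball k v → Covered v
  Ball⇒Covered = Ball-mono

  level-Adj∖F : ∀ {v w} → Adj∖F v w → Covered w → level v ≤ suc (level w)
  level-Adj∖F {w = w} e cw = level-minimal (Ball-step {level w} e (Ball-level cw))

  level≡0⇒Centre : ∀ {v} → Covered v → level v ≡ 0 → Centre v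
  level≡0⇒Centre cv l≡0 = subst (λ k → Ball k _) l≡0 (Ball-level cv)

  Candidate : Fin n → Fin n → Set
  Candidate v w = Adj∖F v w × Ball (pred (level v)) w

  opaque
    parent : Fin n → Fin n
    parent v = choose (λ w → Adj∖F? v w ×-dec Ball? (pred (level v)) w) v

    -- v sits at distance exactly level v from the centres, so it has a neighbour one level lower.
    candidate-exists : ∀ {v} → Covered v → ¬ Centre v → ∃ (Candidate v)
    candidate-exists {v} cv ¬cv with level v in lv | Ball-level cv
    ... | zero  | c                = ⊥-elim (¬cv c)
    ... | suc k | inj₁ b           = ⊥-elim (ℕ.n≮n k (subst (_≤ k) lv (level-minimal b)))
    ... | suc k | inj₂ (w , e , b) = w , e , b

    parent-candidate : ∀ {v} → Covered v → ¬ Centre v → Candidate v (parent v)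
    parent-candidate {v} cv ¬cv =
      choose-holds (λ w → Adj∖F? v w ×-dec Ball? (pred (level v)) w) v (proj₂ (candidate-exists cv ¬cv))

  Parent : Fin n → Fin n → Set
  Parent v w = Covered v × ¬ Centre v × parent v ≡ w

  opaque
    Parent? : ∀ v w → Dec (Parent v w)
    Parent? v w = Covered? v ×-dec ¬? (Centre? v) ×-dec parent v ≟ w

  Parent-functional : ∀ {v w w′} → Parent v w → Parent v w′ → w ≡ w′
  Parent-functional (_ , _ , refl) (_ , _ , refl) = refl

  Parent-candidate : ∀ {v w} → Parent v w → Candidate v w
  Parent-candidate (cv , ¬cv , refl) = parent-candidate cv ¬cv

  Parent-Adj∖F : ∀ {v w} → Parent v w → Adj∖F v w
  Parent-Adj∖F = proj₁ ∘ Parent-candidate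

  Parent-covered : ∀ {v w} → Parent v w → Covered w
  Parent-covered {v} p = Ball⇒Covered (ℕ.≤⇒pred≤ (level≤3 v)) (proj₂ (Parent-candidate p))

  Parent-level : ∀ {v w} → Parent v w → suc (level w) ≡ level v
  Parent-level {v} p@(cv , ¬cv , _) = ℕ.≤-antisym
    (ℕ.m≤pred[n]⇒suc[m]≤n {{≢-nonZero (¬cv ∘ level≡0⇒Centre cv)}}
                          (level-minimal (proj₂ (Parent-candidate p))))
    (level-Adj∖F (Parent-Adj∖F p) (Parent-covered p))

  TreeEdge : Fin n → Fin n → Set
  TreeEdge u v = Parent u v ⊎ Parent v u

  treeEdge : Fin n → Fin n → Bool
  treeEdge u v = does (Parent? u v ⊎-dec Parent? v u)

  treeEdge⁻ : ∀ {u v} → treeEdge u v ≡ true → TreeEdge u v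
  treeEdge⁻ = does-true⁻ (Parent? _ _ ⊎-dec Parent? _ _)

  treeEdge⁺ : ∀ {u v} → TreeEdge u v → treeEdge u v ≡ true
  treeEdge⁺ = dec-true (Parent? _ _ ⊎-dec Parent? _ _)

  treeEdge-sym : ∀ u v → treeEdge u v ≡ treeEdge v u
  treeEdge-sym u v =
    does-⇔ (mk⇔ Sum.swap Sum.swap) (Parent? u v ⊎-dec Parent? v u) (Parent? v u ⊎-dec Parent? u v)

  TreeEdge-Adj∖F : ∀ {u v} → TreeEdge u v → Adj∖F u v
  TreeEdge-Adj∖F (inj₁ p) = Parent-Adj∖F p
  TreeEdge-Adj∖F (inj₂ p) = Adj∖F-sym (Parent-Adj∖F p)

  TreeEdge-covered : ∀ {u v} → TreeEdge u v → Covered u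
  TreeEdge-covered (inj₁ p) = proj₁ p
  TreeEdge-covered (inj₂ p) = Parent-covered p

  TreeReach : Fin n → Fin n → Set
  TreeReach = Reach (λ u v → treeEdge u v ≡ true)

  TreeReach-sym : ∀ {u v} → TreeReach u v → TreeReach v u
  TreeReach-sym = Reach-sym λ {u} {v} e → trans (treeEdge-sym v u) e

  Parent-TreeReach : ∀ {v w} → Parent v w → TreeReach v w
  Parent-TreeReach p = step (treeEdge⁺ (inj₁ p)) here

  up : Fin n → Fin n
  up v = if does (Centre? v) then v else parent v

  up-Centre : ∀ {v} → Centre v → up v ≡ v
  up-Centre {v} c rewrite dec-true (Centre? v) c = refl

  up-Parent : ∀ {v w} → Parent v w → up v ≡ w
  up-Parent {v} (_ , ¬c , refl) rewrite dec-false (Centre? v) ¬c = refl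

  UpStep : Fin n → Fin n → Set
  UpStep v u = Covered u × level u ≡ pred (level v) × TreeReach v u

  up-covered : ∀ {v} → Covered v → UpStep v (up v)
  up-covered {v} cv with Centre? v
  ... | yes c = cv , trans l≡0 (cong pred (≡.sym l≡0)) , here
    where l≡0 = ℕ.n≤0⇒n≡0 (level-minimal {0} c)
  ... | no ¬c = Parent-covered p , cong pred (Parent-level p) , Parent-TreeReach p
    where p : Parent v (parent v)
          p = cv , ¬c , refl

  origin : Fin n → Fin n
  origin v = up (up (up v))

  origin-covered : ∀ {v} → Covered v → Centre (origin v) × TreeReach v (origin v)
  origin-covered {v} c₀ with up-covered c₀
  ... | c₁ , l₁ , r₁ with up-covered c₁
  ...   | c₂ , l₂ , r₂ with up-covered c₂
  ...     | c₃ , l₃ , r₃ =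
    level≡0⇒Centre c₃ (trans l₃ (trans (cong pred (trans l₂ (cong pred l₁))) (pred³-≤3 (level≤3 v)))) ,
    Reach-trans r₁ (Reach-trans r₂ r₃)
    where
    pred³-≤3 : ∀ {k} → k ≤ 3 → pred (pred (pred k)) ≡ 0
    pred³-≤3 z≤n                   = refl
    pred³-≤3 (s≤s z≤n)             = refl
    pred³-≤3 (s≤s (s≤s z≤n))       = refl
    pred³-≤3 (s≤s (s≤s (s≤s z≤n))) = refl

  origin-Centre : ∀ {a} → Centre a → origin a ≡ a
  origin-Centre c rewrite up-Centre c | up-Centre c = up-Centre c

  -- up fixes the centre origin v, and up v = w.
  origin-Parent : ∀ {v w} → Parent v w → origin v ≡ origin w
  origin-Parent {v} p@(cv , _) = trans (≡.sym (up-Centre (proj₁ (origin-covered cv))))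
                                       (cong (λ x → up (up (up x))) (up-Parent p))

  origin-TreeReach : ∀ {u v} → TreeReach u v → origin u ≡ origin v
  origin-TreeReach = Reach-invariant origin λ e → Sum.[ origin-Parent , ≡.sym ∘ origin-Parent ] (treeEdge⁻ e)

  treeDegree : Fin n → ℕ
  treeDegree v = count (treeEdge v)

  treeDegree≤3 : ∀ {v} → OutF F v → treeDegree v ≤ 3
  treeDegree≤3 {v} ov = ℕ.≤-trans (count-mono outside-neighbour) (ℕ.≮⇒≥ (outDeg≤3 v ov))
    where
    outside-neighbour : treeEdge v ⊆ᵇ (λ w → adj G v w ∧ not (vert F w))
    outside-neighbour w e with TreeEdge-Adj∖F (treeEdge⁻ e)
    ... | vw , _ , ow = ∧-intro vw (cong not ow)

  treeDegree-other : ∀ {c r} → treeEdge c r ≡ true → count (λ w → treeEdge c w ∧ (w ≠ᵇ r)) < treeDegree c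
  treeDegree-other {c} {r} cr =
    count-< r (trans (cong (treeEdge c r ∧_) (≠ᵇ-irrefl r)) (Bool.∧-zeroʳ _)) cr (λ w → Bool.∧-conicalˡ _ _)

  Centre-neighbour-Parent : ∀ {a w} → Centre a → Adj G a w → Parent w a
  Centre-neighbour-Parent {a} {w} ca aw = cw , ¬cw , parent≡a
    where
    e : Adj∖F a w
    e = InU-Adj∖F (Centre⇒InU ca) aw
    bw : Ball 1 w
    bw = Ball-step {0} (Adj∖F-sym e) ca
    cw : Covered w
    cw = Ball⇒Covered {1} (s≤s z≤n) bw
    ¬cw : ¬ Centre w
    ¬cw cw′ = Centre-separated ca cw′ (Adj∖F-irrefl e) (inj₂ (inj₁ e))
    p : Parent w (parent w)
    p = cw , ¬cw , refl
    centre-p : Centre (parent w)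
    centre-p = level≡0⇒Centre (Parent-covered p)
      (ℕ.n≤0⇒n≡0 (ℕ.≤-pred (ℕ.≤-trans (ℕ.≤-reflexive (Parent-level p)) (level-minimal bw))))
    parent≡a : parent w ≡ a
    parent≡a = decidable-stable (parent w ≟ a) λ p≢a →
      Centre-separated ca centre-p (p≢a ∘ ≡.sym) (inj₂ (inj₂ (w , e , Parent-Adj∖F p)))

  treeDegree-Centre : ∀ {a} → Centre a → treeDegree a ≡ 3
  treeDegree-Centre {a} ca = ℕ.≤-antisym (treeDegree≤3 (proj₁ (Centre⇒InU ca)))
    (ℕ.≤-trans (min-degree a)
               (count-mono {q = treeEdge a} λ _ aw → treeEdge⁺ (inj₂ (Centre-neighbour-Parent ca aw))))

  Branching : Fin n → Fin n → Set
  Branching s u = origin u ≡ s × Covered u × treeDegree u ≡ 3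

  Branching? : ∀ s u → Dec (Branching s u)
  Branching? s u = origin u ≟ s ×-dec Covered? u ×-dec treeDegree u ℕ.≟ 3

  rootOf : Fin n → Fin n
  rootOf s = argmax level s (filter (Branching? s) (allFin n))

  Centre-Branching : ∀ {a} → Centre a → Branching a a
  Centre-Branching ca = origin-Centre ca , Ball⇒Covered {0} z≤n ca , treeDegree-Centre ca

  rootOf-Branching : ∀ {s} → Centre s → Branching s (rootOf s)
  rootOf-Branching {s} cs = argmax-all level (Centre-Branching cs) (all-filter (Branching? s) (allFin n))

  level≤level-rootOf : ∀ {s u} → Branching s u → level u ≤ level (rootOf s)
  level≤level-rootOf {s} {u} bu =
    All.lookup (f[xs]≤f[argmax] {f = level} s _) (∈-filter⁺ (Branching? s) (∈-allFin u) bu)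

  IsRoot : Fin n → Set
  IsRoot r = Covered r × rootOf (origin r) ≡ r

  IsRoot? : ∀ r → Dec (IsRoot r)
  IsRoot? r = Covered? r ×-dec rootOf (origin r) ≟ r

  IsRoot-Branching : ∀ {r} → IsRoot r → Branching (origin r) r
  IsRoot-Branching {r} (cr , rootOf≡r) =
    subst (Branching (origin r)) rootOf≡r (rootOf-Branching (proj₁ (origin-covered cr)))

  IsRoot-treeDegree : ∀ {r} → IsRoot r → treeDegree r ≡ 3
  IsRoot-treeDegree = proj₂ ∘ proj₂ ∘ IsRoot-Branching

  -- A branching child would lie in the same tree as the root, one level deeper.
  IsRoot-child-treeDegree : ∀ {r c} → IsRoot r → Parent c r → treeDegree c ≤ 2
  IsRoot-child-treeDegree {r} {c} (_ , rootOf≡r) p with treeDegree c ℕ.≟ 3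
  ... | no  deg≢3 = ℕ.≤-pred (ℕ.≤∧≢⇒< (treeDegree≤3 (Ball⇒OutF 3 (proj₁ p))) deg≢3)
  ... | yes deg≡3 = ⊥-elim (ℕ.n≮n (level r)
    (ℕ.≤-trans (ℕ.≤-reflexive (Parent-level p))
               (ℕ.≤-trans (level≤level-rootOf (origin-Parent p , proj₁ p , deg≡3))
                          (ℕ.≤-reflexive (cong level rootOf≡r)))))

  root-exists : ∀ {v} → Covered v → ∃ λ r → IsRoot r × TreeReach v r
  root-exists {v} cv = r , (cr , cong rootOf origin-r) ,
    Reach-trans v↝s (subst (λ x → TreeReach x r) origin-r (TreeReach-sym (proj₂ (origin-covered cr))))
    where
    s = origin v
    cs = proj₁ (origin-covered cv)
    v↝s = proj₂ (origin-covered cv)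
    r = rootOf s
    origin-r = proj₁ (rootOf-Branching cs)
    cr = proj₁ (proj₂ (rootOf-Branching cs))

  IsRoot-unique : ∀ {r r′} → IsRoot r → IsRoot r′ → TreeReach r r′ → r ≡ r′
  IsRoot-unique (_ , rootOf≡r) (_ , rootOf≡r′) r↝r′ =
    trans (≡.sym rootOf≡r) (trans (cong rootOf (origin-TreeReach r↝r′)) rootOf≡r′)

  other-children≤2 : ∀ {c r} → treeEdge c r ≡ true → count (λ w → treeEdge c w ∧ (w ≠ᵇ r)) ≤ 2
  other-children≤2 cr =
    ℕ.≤-pred (ℕ.≤-trans (treeDegree-other cr) (treeDegree≤3 (Ball⇒OutF 3 (TreeEdge-covered (treeEdge⁻ cr)))))

  -- Only the parent of r can contribute two grandchildren: any other child has r as its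
  -- parent and is not branching.
  grandchildren-through : ∀ {r} → IsRoot r → ∀ c →
    count (λ w → treeEdge r c ∧ (treeEdge c w ∧ (w ≠ᵇ r))) ≤
    indicator (treeEdge r c) + indicator (does (Parent? r c))
  grandchildren-through {r} ir c with treeEdge r c in rc
  ... | false = ℕ.≤-trans (ℕ.≤-reflexive (count-none {n} (λ _ → false) λ _ ())) z≤n
  ... | true with Parent? r c | treeEdge⁻ rc
  ...   | yes _ | _       = other-children≤2 (trans (treeEdge-sym c r) rc)
  ...   | no  _ | inj₂ cr =
    ℕ.≤-pred (ℕ.≤-trans (treeDegree-other (treeEdge⁺ (inj₁ cr))) (IsRoot-child-treeDegree ir cr))
  ...   | no ¬p | inj₁ p  = ⊥-elim (¬p p)

  grandchildren≤5 : ∀ {r} → IsRoot r →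
    count (λ w → (w ≠ᵇ r) ∧ anyFin (λ c → treeEdge r c ∧ treeEdge c w)) ≤ 5
  grandchildren≤5 {r} ir = begin
    count (λ w → (w ≠ᵇ r) ∧ anyFin (λ c → treeEdge r c ∧ treeEdge c w))
      ≤⟨ count-mono through-child ⟩
    count (λ w → anyFin (λ c → via c w))
      ≤⟨ count-anyFin≤sum via ⟩
    sum (λ c → count (via c))
      ≤⟨ sum-mono-≤ (grandchildren-through ir) ⟩
    sum (λ c → indicator (treeEdge r c) + indicator (does (Parent? r c)))
      ≡⟨ ∑-distrib-+ (indicator ∘ treeEdge r) (indicator ∘ does ∘ Parent? r) ⟩
    sum (indicator ∘ treeEdge r) + sum (indicator ∘ does ∘ Parent? r)
      ≡⟨ cong₂ _+_ (≡.sym (count≡sum (treeEdge r))) (≡.sym (count≡sum (does ∘ Parent? r))) ⟩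
    treeDegree r + count (does ∘ Parent? r)
      ≤⟨ ℕ.+-mono-≤ (ℕ.≤-reflexive (IsRoot-treeDegree ir)) (count-≤1 (does ∘ Parent? r) one-parent) ⟩
    4
      <⟨ ℕ.n<1+n 4 ⟩
    5 ∎
    where
    open ℕ.≤-Reasoning
    via : Fin n → Fin n → Bool
    via c w = treeEdge r c ∧ (treeEdge c w ∧ (w ≠ᵇ r))
    through-child : (λ w → (w ≠ᵇ r) ∧ anyFin (λ c → treeEdge r c ∧ treeEdge c w))
                    ⊆ᵇ (λ w → anyFin (λ c → via c w))
    through-child w e with anyFin-elim (λ c → treeEdge r c ∧ treeEdge c w) (Bool.∧-conicalʳ (w ≠ᵇ r) _ e)
    ... | c , rcw = anyFin-intro (λ c → via c w) c
      (∧-intro (Bool.∧-conicalˡ (treeEdge r c) _ rcw)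
               (∧-intro (Bool.∧-conicalʳ (treeEdge r c) _ rcw) (Bool.∧-conicalˡ (w ≠ᵇ r) _ e)))
    one-parent : ∀ c c′ → does (Parent? r c) ≡ true → does (Parent? r c′) ≡ true → c ≡ c′
    one-parent c c′ p p′ = Parent-functional (does-true⁻ (Parent? r c) p) (does-true⁻ (Parent? r c′) p′)

  ballForest : SubForest G
  ballForest = record
    { vert      = does ∘ Covered?
    ; edge      = treeEdge
    ; edge-sym  = treeEdge-sym
    ; edge-adj  = λ _ _ → proj₁ ∘ TreeEdge-Adj∖F ∘ treeEdge⁻
    ; edge-vert = λ u _ → dec-true (Covered? u) ∘ TreeEdge-covered ∘ treeEdge⁻
    ; acyclic   = ParentForest.¬IsCycle (λ u v → treeEdge u v ≡ true) Parent level
                    treeEdge⁻ Parent-functional (ℕ.≤-reflexive ∘ Parent-level)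
    }

  chromaticForest : ChromaticForest F
  chromaticForest = record
    { forest             = ballForest
    ; avoidF             = λ v → Ball⇒OutF 3 ∘ does-true⁻ (Covered? v)
    ; isRoot             = does ∘ IsRoot?
    ; root-in            = λ r → dec-true (Covered? r) ∘ proj₁ ∘ does-true⁻ (IsRoot? r)
    ; rooted             = λ v cv → Product.map₂ (Product.map₁ (dec-true (IsRoot? _)))
                                      (root-exists (does-true⁻ (Covered? v) cv))
    ; root-unique        = λ r r′ ir ir′ →
                             IsRoot-unique (does-true⁻ (IsRoot? r) ir) (does-true⁻ (IsRoot? r′) ir′)
    ; three-children     = λ r → IsRoot-treeDegree ∘ does-true⁻ (IsRoot? r)
    ; child-children     = λ r c _ rc → other-children≤2 (trans (treeEdge-sym c r) rc)
    ; five-grandchildren = λ r → grandchildren≤5 ∘ does-true⁻ (IsRoot? r)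
    }

  maximal : MaximalHighMagChromatic F chromaticForest
  maximal = (λ v → dec-true (Covered? v) ∘ inj₁ ∘ InU⇒Ball₂)
          , λ { x ((outside-x , _) , u , (u∈U , _) , xu) →
                  dec-true (Covered? x) (Ball-step {2} (xu , outside-x , proj₁ u∈U) (InU⇒Ball₂ u∈U)) }

lemma6 : ∀ (n : ℕ) (G : Graph n) → MinDegree3 G → NoDeg3Cycle G → NoLargeDeg3Component G →
    ∀ (F : SubForest G) → MaximalLowMagBushy F →
    ∃ λ (C : ChromaticForest F) → MaximalHighMagChromatic F C
lemma6 n G min-degree _ _ F (_ , (outDeg≤3 , _) , _) = chromaticForest , maximal
  where
  open Construction G F min-degree outDeg≤3
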